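{- Let $X_1,X_2,X_3$ be pairwise disjoint vertex subsets of $G_3$ with $V(G_3)=X_1\cup X_2\cup X_3$ and $|X_1|\ge|X_2|\ge|X_3|>0$. Suppose there exist $1\le s<t\le 3$ with $e(X_s,X_t)=0$. Then $|X_t|=1$ or $\sum_{1\le i<j\le 3}e(X_i,X_j)\ge 8$.
   Context: $G_3$ is the 3-dimensional locally twisted cube: vertex set $\{0,1\}^3$ and the 12 edges $000\text{ - }001$, $001\text{ - }011$, $011\text{ - }010$, $010\text{ - }000$, $100\text{ - }101$, $101\text{ - }111$, $111\text{ - }110$, $110\text{ - }100$, $000\text{ - }100$, $010\text{ - }110$, $001\text{ - }111$, $011\text{ - }101$. For vertex sets $X,Y$, $e(X,Y)$ is the number of edges with one end in $X$ and the other in $Y$. -}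

module Defs where

open import Data.Nat using (ℕ; zero; suc; _+_)
open import Data.Bool using (Bool; true; false; _∧_; _∨_; if_then_else_)
open import Data.Fin using (Fin; #_)
open import Data.Fin.Subset using (Subset)
open import Data.Vec using (lookup)
open import Data.Product using (_×_; _,_)
open import Data.List using (List; []; _∷_)

-- Vertices of G_3: Fin 8, where the bit string b₂b₁b₀ ∈ {0,1}^3 is encoded
-- as the natural number 4·b₂ + 2·b₁ + b₀ (so 000 ↦ 0, 001 ↦ 1, …, 111 ↦ 7).
V : Set
V = Fin 8

-- The 12 edges of the 3-dimensional locally twisted cube G_3.
edges : List (V × V)
edges =
    (# 0 , # 1)
  ∷ (# 1 , # 3)
  ∷ (# 3 , # 2)
  ∷ (# 2 , # 0)
  ∷ (# 4 , # 5)
  ∷ (# 5 , # 7)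
  ∷ (# 7 , # 6)
  ∷ (# 6 , # 4)
  ∷ (# 0 , # 4)
  ∷ (# 2 , # 6)
  ∷ (# 1 , # 7)
  ∷ (# 3 , # 5)
  ∷ []

_∈ᵇ_ : V → Subset 8 → Bool
v ∈ᵇ X = lookup X v

e : Subset 8 → Subset 8 → ℕ
e X Y = go edges
  where
  go : List (V × V) → ℕ
  go [] = 0
  go ((u , v) ∷ es) =
    (if ((u ∈ᵇ X) ∧ (v ∈ᵇ Y)) ∨ ((v ∈ᵇ X) ∧ (u ∈ᵇ Y)) then 1 else 0) + go es

module Submission where

-- The statement concerns the finitely many ordered partitions
-- (X₁, X₂, X₃) of the 8 vertices of G₃ (there are 3⁸ = 6561 of them), so it
-- is proved by exhaustive computation, organised as proof by reflection.

open import Defs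
open import Data.Bool using (Bool; true; false; T; not; _∧_; _∨_)
open import Data.Bool.Properties using (T-∧; T-∨; T-≡)
open import Data.Empty using (⊥-elim)
open import Data.Fin using (Fin; zero; suc)
open import Data.Fin.Subset using (Subset; _∈_; ∣_∣; _∪_; ⊤)
open import Data.Fin.Subset.Properties using (∈⊤; x∈p∪q⁻)
open import Data.Nat using (ℕ; _+_; _≥_; _<_; _≤_; _≡ᵇ_; _≤ᵇ_; s≤s)
open import Data.Nat.Properties using (≡ᵇ⇒≡; ≤ᵇ⇒≤; ≤⇒≤ᵇ)
open import Data.Product using (_×_; _,_; proj₁; proj₂)
open import Data.Sum using (_⊎_; inj₁; inj₂)
open import Data.Vec using ([]; _∷_; lookup)
open import Data.Vec.Properties using (lookup⇒[]=; []=⇒lookup)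
open import Function using (_∘_)
open import Function.Bundles using (Equivalence)
open import Relation.Binary.PropositionalEquality using (_≡_; sym; subst)
open import Relation.Nullary using (¬_)

open Equivalence using (to; from)

exactlyOne : Bool → Bool → Bool → Bool
exactlyOne x y z = (x ∧ not y ∧ not z) ∨ (not x ∧ y ∧ not z) ∨ (not x ∧ not y ∧ z)

Partition3 : ∀ {n} → Subset n → Subset n → Subset n → Set
Partition3 a b c = ∀ v → T (exactlyOne (lookup a v) (lookup b v) (lookup c v))

Pred3 : ℕ → Set
Pred3 n = Subset n → Subset n → Subset n → Bool

placeFirst : ∀ {n} → Bool → Bool → Bool → Pred3 (ℕ.suc n) → Pred3 n
placeFirst x y z f a b c = f (x ∷ a) (y ∷ b) (z ∷ c)

allPartitions : ∀ n → Pred3 n → Bool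
allPartitions ℕ.zero    f = f [] [] []
allPartitions (ℕ.suc n) f =
      allPartitions n (placeFirst true  false false f)
    ∧ allPartitions n (placeFirst false true  false f)
    ∧ allPartitions n (placeFirst false false true  f)

allPartitions-branches : ∀ n (f : Pred3 (ℕ.suc n)) → T (allPartitions (ℕ.suc n) f)
  → T (allPartitions n (placeFirst true  false false f))
  × T (allPartitions n (placeFirst false true  false f))
  × T (allPartitions n (placeFirst false false true  f))
allPartitions-branches n f passes with T-∧ .to passes
... | first , rest = first , T-∧ .to rest

-- The first element lies in exactly one part, which
-- selects the branch; the tails form a 3-partition of Fin n.
allPartitions-sound : ∀ n (f : Pred3 n) a b c →
  Partition3 a b c → T (allPartitions n f) → T (f a b c)
allPartitions-sound ℕ.zero f [] [] [] _ passes = passes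
allPartitions-sound (ℕ.suc n) f (x ∷ a) (y ∷ b) (z ∷ c) part passes
  with x | y | z | part zero | allPartitions-branches n f passes
... | true  | false | false | _  | p , _ , _ = allPartitions-sound n _ a b c (part ∘ suc) p
... | false | true  | false | _  | _ , p , _ = allPartitions-sound n _ a b c (part ∘ suc) p
... | false | false | true  | _  | _ , _ , p = allPartitions-sound n _ a b c (part ∘ suc) p
... | true  | true  | _     | () | _
... | true  | false | true  | () | _
... | false | true  | true  | () | _
... | false | false | false | () | _

exactlyOne-intro : ∀ x y z → (T x ⊎ T y) ⊎ T z
  → (T x → ¬ T y) → (T x → ¬ T z) → (T y → ¬ T z) → T (exactlyOne x y z)
exactlyOne-intro true  true  _     _ xy _  _  = ⊥-elim (xy _ _)
exactlyOne-intro true  false true  _ _  xz _  = ⊥-elim (xz _ _)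
exactlyOne-intro true  false false _ _  _  _  = _
exactlyOne-intro false true  true  _ _  _  yz = ⊥-elim (yz _ _)
exactlyOne-intro false true  false _ _  _  _  = _
exactlyOne-intro false false true  _ _  _  _  = _
exactlyOne-intro false false false (inj₁ (inj₁ ())) _ _ _
exactlyOne-intro false false false (inj₁ (inj₂ ())) _ _ _
exactlyOne-intro false false false (inj₂ ()) _ _ _

∈⇒T : ∀ {n} {p : Subset n} {v} → v ∈ p → T (lookup p v)
∈⇒T v∈p = T-≡ .from ([]=⇒lookup v∈p)

T⇒∈ : ∀ {n} (p : Subset n) v → T (lookup p v) → v ∈ p
T⇒∈ p v t = lookup⇒[]= v p (T-≡ .to t)

partition-intro : ∀ {n} (X : Fin 3 → Subset n)
  → (∀ (i j : Fin 3) → ¬ (i ≡ j) → ∀ (v : Fin n) → v ∈ X i → ¬ (v ∈ X j))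
  → (X zero ∪ X (suc zero)) ∪ X (suc (suc zero)) ≡ ⊤
  → Partition3 (X zero) (X (suc zero)) (X (suc (suc zero)))
partition-intro X disjoint cover v =
  exactlyOne-intro _ _ _ covered (apart zero (suc zero) (λ ()))
    (apart zero (suc (suc zero)) (λ ())) (apart (suc zero) (suc (suc zero)) (λ ()))
  where
  covered : (T (lookup (X zero) v) ⊎ T (lookup (X (suc zero)) v))
          ⊎ T (lookup (X (suc (suc zero))) v)
  covered with x∈p∪q⁻ _ _ (subst (v ∈_) (sym cover) ∈⊤)
  ... | inj₂ v∈c = inj₂ (∈⇒T v∈c)
  ... | inj₁ v∈a∪b with x∈p∪q⁻ _ _ v∈a∪b
  ...   | inj₁ v∈a = inj₁ (inj₁ (∈⇒T v∈a))
  ...   | inj₂ v∈b = inj₁ (inj₂ (∈⇒T v∈b))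
  apart : ∀ i j → ¬ (i ≡ j) → T (lookup (X i) v) → ¬ T (lookup (X j) v)
  apart i j i≢j ti tj = disjoint i j i≢j v (T⇒∈ (X i) v ti) (T⇒∈ (X j) v tj)

implicationᵇ-elim : ∀ h c → T (not h ∨ c) → T h → T c
implicationᵇ-elim true c holds _ = holds

crossEdges : Subset 8 → Subset 8 → Subset 8 → ℕ
crossEdges a b c = e a b + e a c + e b c

sizesOrderedᵇ : Subset 8 → Subset 8 → Subset 8 → Bool
sizesOrderedᵇ a b c = (1 ≤ᵇ ∣ c ∣) ∧ (∣ b ∣ ≤ᵇ ∣ a ∣) ∧ (∣ c ∣ ≤ᵇ ∣ b ∣)

pairConclusionᵇ : ℕ → Subset 8 → Subset 8 → Bool
pairConclusionᵇ total s t = not (e s t ≡ᵇ 0) ∨ (∣ t ∣ ≡ᵇ 1) ∨ (8 ≤ᵇ total)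

allPairsConclusionᵇ : ℕ → (Fin 3 → Subset 8) → Bool
allPairsConclusionᵇ total X =
    pairConclusionᵇ total (X zero)       (X (suc zero))
  ∧ pairConclusionᵇ total (X zero)       (X (suc (suc zero)))
  ∧ pairConclusionᵇ total (X (suc zero)) (X (suc (suc zero)))

parts : Subset 8 → Subset 8 → Subset 8 → Fin 3 → Subset 8
parts a b c zero             = a
parts a b c (suc zero)       = b
parts a b c (suc (suc zero)) = c

lemma2p7ᵇ : Pred3 8
lemma2p7ᵇ a b c =
  not (sizesOrderedᵇ a b c) ∨ allPairsConclusionᵇ (crossEdges a b c) (parts a b c)

lemma2p7ᵇ-holds : T (allPartitions 8 lemma2p7ᵇ)
lemma2p7ᵇ-holds = _

pairConclusion-reflect : ∀ total s t → T (pairConclusionᵇ total s t)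
  → e s t ≡ 0 → ∣ t ∣ ≡ 1 ⊎ 8 ≤ total
pairConclusion-reflect total s t holds noEdges with T-∨ .to holds
... | inj₁ someEdge = ⊥-elim (subst (λ k → T (not (k ≡ᵇ 0))) noEdges someEdge)
... | inj₂ rest with T-∨ .to rest
...   | inj₁ single = inj₁ (≡ᵇ⇒≡ _ _ single)
...   | inj₂ many   = inj₂ (≤ᵇ⇒≤ _ _ many)

pairConclusion-select : ∀ total (X : Fin 3 → Subset 8) → T (allPairsConclusionᵇ total X)
  → ∀ (s t : Fin 3) → s Data.Fin.< t → T (pairConclusionᵇ total (X s) (X t))
pairConclusion-select total X holds = select
  where
  P : Fin 3 → Fin 3 → Bool
  P i j = pairConclusionᵇ total (X i) (X j)
  first : T (P zero (suc zero)) × T (P zero (suc (suc zero)) ∧ P (suc zero) (suc (suc zero)))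
  first = T-∧ .to holds
  rest : T (P zero (suc (suc zero))) × T (P (suc zero) (suc (suc zero)))
  rest = T-∧ .to (proj₂ first)
  select : ∀ (s t : Fin 3) → s Data.Fin.< t → T (P s t)
  select zero             (suc zero)       _ = proj₁ first
  select zero             (suc (suc zero)) _ = proj₁ rest
  select (suc zero)       (suc (suc zero)) _ = proj₂ rest
  select zero             zero             ()
  select (suc zero)       zero             ()
  select (suc zero)       (suc zero)       (s≤s ())
  select (suc (suc zero)) zero             ()
  select (suc (suc zero)) (suc zero)       (s≤s ())
  select (suc (suc zero)) (suc (suc zero)) (s≤s (s≤s ()))

lemma2p7 : (X : Fin 3 → Subset 8)
    → (∀ (i j : Fin 3) → ¬ (i ≡ j) → ∀ (v : Fin 8) → v ∈ X i → ¬ (v ∈ X j))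
    → (X zero ∪ X (suc zero)) ∪ X (suc (suc zero)) ≡ ⊤
    → ∣ X zero ∣ ≥ ∣ X (suc zero) ∣
    → ∣ X (suc zero) ∣ ≥ ∣ X (suc (suc zero)) ∣
    → 0 < ∣ X (suc (suc zero)) ∣
    → (s t : Fin 3) → s Data.Fin.< t → e (X s) (X t) ≡ 0
    → ∣ X t ∣ ≡ 1
      ⊎ 8 ≤ e (X zero) (X (suc zero)) + e (X zero) (X (suc (suc zero)))
            + e (X (suc zero)) (X (suc (suc zero)))
lemma2p7 X disjoint cover |a|≥|b| |b|≥|c| |c|>0 s t s<t noEdges =
  pairConclusion-reflect total (X s) (X t)
    (pairConclusion-select total X allPairs s t s<t) noEdges
  where
  a = X zero
  b = X (suc zero)
  c = X (suc (suc zero))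
  total = crossEdges a b c
  holds : T (lemma2p7ᵇ a b c)
  holds = allPartitions-sound 8 lemma2p7ᵇ a b c
            (partition-intro X disjoint cover) lemma2p7ᵇ-holds
  ordered : T (sizesOrderedᵇ a b c)
  ordered = T-∧ .from (≤⇒≤ᵇ |c|>0 , T-∧ .from (≤⇒≤ᵇ |a|≥|b| , ≤⇒≤ᵇ |b|≥|c|))
  allPairs : T (allPairsConclusionᵇ total X)
  allPairs = implicationᵇ-elim (sizesOrderedᵇ a b c) _ holds ordered
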